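{- $cr(LTQ_4) \leq 10$ and $cr(LTQ_5) \leq 68$.
   Context: The $n$-dimensional locally twisted cube $LTQ_n$ ($n \geq 2$) is the graph defined recursively as follows. Its vertices are the binary strings $x_1x_2\cdots x_n$ of length $n$. $LTQ_2$ is the 4-cycle $Q_2$ on $\{00,01,10,11\}$ (two strings adjacent iff they differ in exactly one bit). For $n \geq 3$, $LTQ_n$ is obtained from two disjoint copies of $LTQ_{n-1}$: one copy $0LTQ_{n-1}$ obtained by prefixing every vertex label with $0$, the other copy $1LTQ_{n-1}$ obtained by prefixing every vertex label with $1$ (edges inside each copy are kept), and additionally each vertex $0x_2x_3\cdots x_n$ is joined to the vertex $1(x_2+x_n)x_3\cdots x_n$, where $+$ denotes addition modulo 2. The crossing number $cr(G)$ of a graph $G$ is the minimum number of pairwise crossings of edges over all drawings of $G$ in the plane. -}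

module Defs where

open import Data.Bool using (Bool; true; false; _xor_; if_then_else_)
open import Data.Nat using (ℕ; zero; suc; _+_; _≤_; _<_)
open import Data.Fin using (Fin; toℕ)
open import Data.Vec using (Vec; []; _∷_; last; head; tail)
open import Data.List using (List; []; _∷_; _++_; map; concat; concatMap; length; lookup; [_])
open import Data.Nat.ListAction using (sum)
open import Data.List.Relation.Unary.Unique.Propositional using (Unique)
open import Data.Product using (_×_; _,_; proj₁; proj₂; ∃)
open import Data.Rational using (ℚ; 0ℚ; _*_; _-_; _<_)
open import Data.Rational.Properties using (_<?_)
open import Relation.Nullary using (¬_; does)
open import Relation.Binary.PropositionalEquality using (_≡_; _≢_)

record Graph : Set₁ where
  field
    V        : Set
    vertices : List V
    edges    : List (V × V)

allVecs : (n : ℕ) → List (Vec Bool n)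
allVecs zero    = [] ∷ []
allVecs (suc n) = map (false ∷_) (allVecs n) ++ map (true ∷_) (allVecs n)

-- LTQ_2 = the 4-cycle 00-01-11-10-00.
-- LTQ_{k+3}: two copies of LTQ_{k+2} prefixed with 0 and 1, plus the edges
--   0 x2 x3 ... xn  --  1 (x2 + xn) x3 ... xn.
prefix : ∀ {m} → Bool → Vec Bool m × Vec Bool m → Vec Bool (suc m) × Vec Bool (suc m)
prefix b (u , v) = (b ∷ u , b ∷ v)

crossEdge : ∀ {m} → Vec Bool (suc m) → Vec Bool (suc (suc m)) × Vec Bool (suc (suc m))
crossEdge x = (false ∷ x , true ∷ (head x xor last x) ∷ tail x)

LTQ-edges : (k : ℕ) → List (Vec Bool (2 + k) × Vec Bool (2 + k))
LTQ-edges zero =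
  (false ∷ false ∷ [] , false ∷ true ∷ []) ∷
  (false ∷ true ∷ []  , true ∷ true ∷ [])  ∷
  (true ∷ true ∷ []   , true ∷ false ∷ []) ∷
  (true ∷ false ∷ []  , false ∷ false ∷ []) ∷ []
LTQ-edges (suc k) =
  map (prefix false) (LTQ-edges k) ++
  map (prefix true) (LTQ-edges k) ++
  map crossEdge (allVecs (2 + k))

-- LTQ k = the (k+2)-dimensional locally twisted cube LTQ_{k+2}
LTQ : ℕ → Graph
LTQ k = record { V = Vec Bool (2 + k) ; vertices = allVecs (2 + k) ; edges = LTQ-edges k }

Point : Set
Point = ℚ × ℚ

orient : Point → Point → Point → ℚ
orient (ax , ay) (bx , by) (cx , cy) = ((bx - ax) * (cy - ay)) - ((by - ay) * (cx - ax))

-- the open segments ab and cd cross at a single interior point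
-- (exact test for segments whose endpoints are in general position)
crossesᵇ : Point × Point → Point × Point → Bool
crossesᵇ (a , b) (c , d) with does ((orient a b c * orient a b d) <? 0ℚ)
... | false = false
... | true  = does ((orient c d a * orient c d b) <? 0ℚ)

segments : List Point → List (Point × Point)
segments []            = []
segments (p ∷ [])      = []
segments (p ∷ q ∷ ps)  = (p , q) ∷ segments (q ∷ ps)

-- A drawing places each vertex at a point and draws each edge (indexed by its
-- position in the edge list) as a polygonal arc with the given list of bend points.
record Drawing (G : Graph) : Set where
  open Graph G
  field
    pos   : V → Point
    bends : Fin (length edges) → List Point

module _ {G : Graph} (D : Drawing G) where
  open Graph G
  open Drawing D

  arc : Fin (length edges) → List Point
  arc i = pos (proj₁ (lookup edges i)) ∷ (bends i ++ [ pos (proj₂ (lookup edges i)) ])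

  allBends : List (List Point)
  allBends = Data.List.map bends (Data.List.allFin (length edges))
    where import Data.List

  allPoints : List Point
  allPoints = map pos vertices ++ concat allBends

  -- This guarantees that vertices are drawn at distinct points, no
  -- arc passes through a vertex point other than its ends, and any two arcs
  -- meet only in common end vertices or in proper (transversal) crossings.
  record IsDrawing : Set where
    field
      distinct      : Unique allPoints
      noCollinear   : (p q r : Fin (length allPoints)) → p ≢ q → q ≢ r → p ≢ r →
                      orient (lookup allPoints p) (lookup allPoints q) (lookup allPoints r) ≢ 0ℚ
      simpleArcs    : (i : Fin (length edges)) (s t : Fin (length (segments (arc i)))) →
                      suc (toℕ s) Data.Nat.< toℕ t →
                      crossesᵇ (lookup (segments (arc i)) s) (lookup (segments (arc i)) t) ≡ false

  crossBetween : List Point → List Point → ℕ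
  crossBetween p q =
    sum (concatMap (λ s → map (λ t → if crossesᵇ s t then 1 else 0) (segments q)) (segments p))

  pairCrossings : List (List Point) → ℕ
  pairCrossings []       = 0
  pairCrossings (p ∷ ps) = sum (map (crossBetween p) ps) + pairCrossings ps

  crossings : ℕ
  crossings = pairCrossings (map arc (Data.List.allFin (length edges)))
    where import Data.List

CrAtMost : Graph → ℕ → Set
CrAtMost G k = ∃ λ (D : Drawing G) → IsDrawing D × crossings D ≤ k

module Submission where

-- Both bounds are witnessed by explicit straight-line drawings with integer
-- vertex coordinates. For a straight-line drawing, validity reduces to two
-- finite checks on the vertex positions (pairwise distinct, no three
-- collinear), and these as well as the crossing count are decided by
-- evaluation over ℚ.

open import Defs
open import Data.Bool using (Bool; true; false; T; not; _∨_)
open import Data.Bool.ListAction using (all)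
open import Data.Empty using (⊥-elim)
open import Data.Fin using (Fin; zero; suc; toℕ)
open import Data.Integer using (+_)
open import Data.List using (List; []; _∷_; length; lookup)
open import Data.List.Membership.Propositional.Properties using (∈-lookup)
open import Data.List.Relation.Unary.All as All using (All; _∷_)
open import Data.List.Relation.Unary.All.Properties using (all⁺)
open import Data.List.Relation.Unary.AllPairs using (_∷_)
open import Data.List.Relation.Unary.Unique.Propositional using (Unique)
open import Data.List.Relation.Unary.Unique.DecPropositional using (unique?)
open import Data.Nat using (ℕ; _≤?_; _<_)
import Data.Nat as ℕ
open import Data.Product using (_×_; _,_)
open import Data.Product.Properties using (≡-dec)
open import Data.Rational using (_/_; 0ℚ)
import Data.Rational.Properties as ℚ
open import Data.Unit using (tt)
open import Data.Vec using (Vec; []; _∷_)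
open import Function using (_∘_)
open import Relation.Binary.Definitions using (DecidableEquality)
open import Relation.Binary.PropositionalEquality using (_≡_; _≢_; refl; sym; cong)
open import Relation.Nullary using (does; yes; no)
open import Relation.Nullary.Decidable using (True; toWitness)

_≟ₚ_ : DecidableEquality Point
_≟ₚ_ = ≡-dec ℚ._≟_ ℚ._≟_

point : ℕ → ℕ → Point
point x y = (+ x / 1 , + y / 1)

NoThreeCollinear : List Point → Set
NoThreeCollinear ps = (p q r : Fin (length ps)) → p ≢ q → q ≢ r → p ≢ r →
                      orient (lookup ps p) (lookup ps q) (lookup ps r) ≢ 0ℚ

nonCollinearᵇ : Point → Point → Point → Bool
nonCollinearᵇ a b c =
  does (a ≟ₚ b) ∨ does (b ≟ₚ c) ∨ does (a ≟ₚ c) ∨ not (does (orient a b c ℚ.≟ 0ℚ))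

noThreeCollinearᵇ : List Point → Bool
noThreeCollinearᵇ ps = all (λ a → all (λ b → all (nonCollinearᵇ a b) ps) ps) ps

nonCollinearᵇ-sound : ∀ a b c → T (nonCollinearᵇ a b c) →
                      a ≢ b → b ≢ c → a ≢ c → orient a b c ≢ 0ℚ
nonCollinearᵇ-sound a b c h a≢b b≢c a≢c with a ≟ₚ b | b ≟ₚ c | a ≟ₚ c
... | yes a≡b | _       | _       = ⊥-elim (a≢b a≡b)
... | no _    | yes b≡c | _       = ⊥-elim (b≢c b≡c)
... | no _    | no _    | yes a≡c = ⊥-elim (a≢c a≡c)
... | no _    | no _    | no _    with orient a b c ℚ.≟ 0ℚ
...   | no ≢0 = ≢0
...   | yes _ = ⊥-elim h

lookup-injective : ∀ {A : Set} {xs : List A} → Unique xs →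
                   (i j : Fin (length xs)) → i ≢ j → lookup xs i ≢ lookup xs j
lookup-injective (x∉xs ∷ u) zero    zero    i≢j = ⊥-elim (i≢j refl)
lookup-injective (x∉xs ∷ u) zero    (suc j) i≢j = All.lookup x∉xs (∈-lookup j)
lookup-injective (x∉xs ∷ u) (suc i) zero    i≢j = All.lookup x∉xs (∈-lookup i) ∘ sym
lookup-injective (x∉xs ∷ u) (suc i) (suc j) i≢j =
  lookup-injective u i j (λ i≡j → i≢j (cong suc i≡j))

noThreeCollinearᵇ-sound : ∀ ps → Unique ps → T (noThreeCollinearᵇ ps) → NoThreeCollinear ps
noThreeCollinearᵇ-sound ps u h p q r p≢q q≢r p≢r =
  nonCollinearᵇ-sound a b c abc
    (lookup-injective u p q p≢q) (lookup-injective u q r q≢r) (lookup-injective u p r p≢r)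
  where
  a = lookup ps p
  b = lookup ps q
  c = lookup ps r
  abc : T (nonCollinearᵇ a b c)
  abc = All.lookup (all⁺ _ ps (All.lookup (all⁺ _ ps (All.lookup (all⁺ _ ps h) (∈-lookup p)))
                                          (∈-lookup q)))
                   (∈-lookup r)

module _ {G : Graph} (pos : Graph.V G → Point) where
  open Graph G

  straightLine : Drawing G
  straightLine = record { pos = pos ; bends = λ _ → [] }

  -- Each arc is a single segment, so there is no pair of non-consecutive segments.
  straightLine-simpleArcs : (i : Fin (length edges))
                            (s t : Fin (length (segments (arc straightLine i)))) →
                            ℕ.suc (toℕ s) < toℕ t →
                            crossesᵇ (lookup (segments (arc straightLine i)) s)
                                     (lookup (segments (arc straightLine i)) t) ≡ false
  straightLine-simpleArcs i s zero ()

  straightLine-isDrawing : Unique (allPoints straightLine) →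
                           T (noThreeCollinearᵇ (allPoints straightLine)) →
                           IsDrawing straightLine
  straightLine-isDrawing u h = record
    { distinct    = u
    ; noCollinear = noThreeCollinearᵇ-sound (allPoints straightLine) u h
    ; simpleArcs  = straightLine-simpleArcs
    }

  straightLine-crAtMost : {k : ℕ} →
                          True (unique? _≟ₚ_ (allPoints straightLine)) →
                          T (noThreeCollinearᵇ (allPoints straightLine)) →
                          True (crossings straightLine ≤? k) →
                          CrAtMost G k
  straightLine-crAtMost distinct noCollinear few =
    straightLine , straightLine-isDrawing (toWitness distinct) noCollinear , toWitness few

LTQ₄-position : Vec Bool 4 → Point
LTQ₄-position (false ∷ false ∷ false ∷ false ∷ []) = point 83 88
LTQ₄-position (false ∷ false ∷ false ∷ true ∷ []) = point 100 78
LTQ₄-position (false ∷ false ∷ true ∷ false ∷ []) = point 56 86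
LTQ₄-position (false ∷ false ∷ true ∷ true ∷ []) = point 107 75
LTQ₄-position (false ∷ true ∷ false ∷ false ∷ []) = point 89 92
LTQ₄-position (false ∷ true ∷ false ∷ true ∷ []) = point 104 78
LTQ₄-position (false ∷ true ∷ true ∷ false ∷ []) = point 60 90
LTQ₄-position (false ∷ true ∷ true ∷ true ∷ []) = point 86 80
LTQ₄-position (true ∷ false ∷ false ∷ false ∷ []) = point 84 93
LTQ₄-position (true ∷ false ∷ false ∷ true ∷ []) = point 114 104
LTQ₄-position (true ∷ false ∷ true ∷ false ∷ []) = point 0 90
LTQ₄-position (true ∷ false ∷ true ∷ true ∷ []) = point 118 59
LTQ₄-position (true ∷ true ∷ false ∷ false ∷ []) = point 93 95
LTQ₄-position (true ∷ true ∷ false ∷ true ∷ []) = point 116 64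
LTQ₄-position (true ∷ true ∷ true ∷ false ∷ []) = point 123 111
LTQ₄-position (true ∷ true ∷ true ∷ true ∷ []) = point 115 92

LTQ₅-position : Vec Bool 5 → Point
LTQ₅-position (false ∷ false ∷ false ∷ false ∷ false ∷ []) = point 620 598
LTQ₅-position (false ∷ false ∷ false ∷ false ∷ true ∷ []) = point 594 661
LTQ₅-position (false ∷ false ∷ false ∷ true ∷ false ∷ []) = point 624 476
LTQ₅-position (false ∷ false ∷ false ∷ true ∷ true ∷ []) = point 581 683
LTQ₅-position (false ∷ false ∷ true ∷ false ∷ false ∷ []) = point 544 663
LTQ₅-position (false ∷ false ∷ true ∷ false ∷ true ∷ []) = point 598 658
LTQ₅-position (false ∷ false ∷ true ∷ true ∷ false ∷ []) = point 443 611
LTQ₅-position (false ∷ false ∷ true ∷ true ∷ true ∷ []) = point 610 637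
LTQ₅-position (false ∷ true ∷ false ∷ false ∷ false ∷ []) = point 629 526
LTQ₅-position (false ∷ true ∷ false ∷ false ∷ true ∷ []) = point 660 633
LTQ₅-position (false ∷ true ∷ false ∷ true ∷ false ∷ []) = point 630 466
LTQ₅-position (false ∷ true ∷ false ∷ true ∷ true ∷ []) = point 630 608
LTQ₅-position (false ∷ true ∷ true ∷ false ∷ false ∷ []) = point 538 666
LTQ₅-position (false ∷ true ∷ true ∷ false ∷ true ∷ []) = point 566 687
LTQ₅-position (false ∷ true ∷ true ∷ true ∷ false ∷ []) = point 335 692
LTQ₅-position (false ∷ true ∷ true ∷ true ∷ true ∷ []) = point 578 697
LTQ₅-position (true ∷ false ∷ false ∷ false ∷ false ∷ []) = point 727 639
LTQ₅-position (true ∷ false ∷ false ∷ false ∷ true ∷ []) = point 673 644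
LTQ₅-position (true ∷ false ∷ false ∷ true ∷ false ∷ []) = point 846 0
LTQ₅-position (true ∷ false ∷ false ∷ true ∷ true ∷ []) = point 693 642
LTQ₅-position (true ∷ false ∷ true ∷ false ∷ false ∷ []) = point 592 727
LTQ₅-position (true ∷ false ∷ true ∷ false ∷ true ∷ []) = point 596 721
LTQ₅-position (true ∷ false ∷ true ∷ true ∷ false ∷ []) = point 160 787
LTQ₅-position (true ∷ false ∷ true ∷ true ∷ true ∷ []) = point 581 699
LTQ₅-position (true ∷ true ∷ false ∷ false ∷ false ∷ []) = point 792 678
LTQ₅-position (true ∷ true ∷ false ∷ false ∷ true ∷ []) = point 629 681
LTQ₅-position (true ∷ true ∷ false ∷ true ∷ false ∷ []) = point 1288 664
LTQ₅-position (true ∷ true ∷ false ∷ true ∷ true ∷ []) = point 613 689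
LTQ₅-position (true ∷ true ∷ true ∷ false ∷ false ∷ []) = point 604 755
LTQ₅-position (true ∷ true ∷ true ∷ false ∷ true ∷ []) = point 644 671
LTQ₅-position (true ∷ true ∷ true ∷ true ∷ false ∷ []) = point 700 783
LTQ₅-position (true ∷ true ∷ true ∷ true ∷ true ∷ []) = point 682 650

proposition1 : CrAtMost (LTQ 2) 10 × CrAtMost (LTQ 3) 68
proposition1 =
  straightLine-crAtMost LTQ₄-position tt tt tt , straightLine-crAtMost LTQ₅-position tt tt tt
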